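{- For all integers $k\ge 2$, $2\le \ell<k$ and $0\le h\le t$, we have $f(\ell,t,h)\le (t-h+1)\,n(\ell,t+1,h)$, where $f$ and $n$ are defined below with respect to $k$-level service patterns.
   Context: Fix $k$. Let $U$ be a finite set of pages and $\sigma=\sigma_1,\dots,\sigma_T$ with $\sigma_t\in U$. A ($k$-level, hierarchical) service pattern is $\mathcal I=\mathcal I_1\cup\dots\cup\mathcal I_k$, where each $\mathcal I_i$ is a partition of $[0,T+1)$ into half-open intervals with integer endpoints (the level-$i$ intervals), such that every level-$i$ interval with $i<k$ is contained in a level-$(i+1)$ interval. The ancestors $A(I)$ of $I$ are the higher-level intervals containing $I$; $T_I$ consists of $I$ and all lower-level intervals contained in $I$; the children of a level-$\ell$ interval are the level-$(\ell-1)$ intervals contained in it. A labeling is a partial map $\alpha$ from intervals to $U$; a labeling of a set $\mathcal J$ of intervals is feasible for $\sigma_I$ (requests at times $t\in I\cap\{1,\dots,T\}$) if for every such $t$ some $J\in\mathcal J$ with $t\in J$ has $\alpha(J)=\sigma_t$. For a level-$\ell$ interval $I$ with $\ell<k$, a set $S\subseteq U$ with $|S|\le k-\ell$ is a valid tuple if some labeling of $T_I\cup A(I)$, feasible for $\sigma_I$, labels every ancestor of $I$ either not at all or by an element of $S$; the request list $L(I)$ is the set of inclusion-minimal valid tuples. For a level-$\ell$ interval $I$ with $\ell\ge2$ and children $C$, the joint request list $L(C)$ is the set of inclusion-minimal $S\subseteq U$ with $|S|\le k-\ell+1$ such that some labeling of $T_I\cup A(I)$, feasible for $\sigma_I$,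 labels each interval of $\{I\}\cup A(I)$ either not at all or by an element of $S$. A $t$-tuple is a set of size $t$. $f(\ell,t,h)$ is the supremum, over all finite $U$, request sequences, $k$-level service patterns, level-$\ell$ intervals $I$ and sets $P\subseteq U$ with $|P|=h$, of the number of $t$-tuples in $L(I)$ containing $P$; $n(\ell,t,h)$ is the analogous supremum of the number of $t$-tuples containing $P$ in the joint request list of the children of a level-$\ell$ interval. -}

module Defs where

open import Data.Nat using (ℕ; zero; suc; _+_; _*_; _∸_; _≤_; _<_)
open import Data.Fin using (Fin; toℕ)
open import Data.Fin.Subset using (Subset; _∈_; _⊆_; ∣_∣)
open import Data.Bool using (Bool; true; false)
open import Data.Maybe using (Maybe; just; nothing)
open import Data.Product using (Σ; ∃; _×_; _,_)
open import Data.Sum using (_⊎_)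
open import Data.List using (List; length)
open import Data.List.Relation.Unary.All using (All)
open import Data.List.Relation.Unary.Unique.Propositional using (Unique)
open import Relation.Nullary using (¬_)
open import Relation.Binary.PropositionalEquality using (_≡_)

-- Time axis: the interval [0, T+1); request σ_t for t = 1..T is given by
-- σ : Fin T → U, where index i : Fin T stands for time suc (toℕ i).
time : {T : ℕ} → Fin T → ℕ
time i = suc (toℕ i)

-- A (k-level) service pattern on [0, T+1).
-- Level i (1 ≤ i ≤ k) partition is given by its set of interior cut points
-- cut i p (only 1 ≤ p ≤ T are meaningful); its intervals are the [a,b)
-- between consecutive boundary points.
record Pattern (k T : ℕ) : Set where
  field
    cut : ℕ → ℕ → Bool

  Boundary : ℕ → ℕ → Set
  Boundary i p = (p ≡ 0) ⊎ ((p ≡ suc T) ⊎ ((1 ≤ p) × (p ≤ T) × (cut i p ≡ true)))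

  LevelInt : ℕ → ℕ → ℕ → Set
  LevelInt i a b =
    (1 ≤ i) × (i ≤ k) × (a < b) × (b ≤ suc T) × Boundary i a × Boundary i b
    × (∀ p → a < p → p < b → ¬ (cut i p ≡ true))

  field
    nested : ∀ i a b → LevelInt i a b → i < k →
             ∃ λ c → ∃ λ d → LevelInt (suc i) c d × (c ≤ a) × (b ≤ d)

open Pattern public

module _ {k T m : ℕ} (sp : Pattern k T) (σ : Fin T → Fin m) where

  -- Intervals are triples (level, left endpoint, right endpoint).
  -- J = (j,c,d) is an ancestor of I = (ℓ,a,b)
  Ancestor : (ℓ a b j c d : ℕ) → Set
  Ancestor ℓ a b j c d = LevelInt sp j c d × (ℓ < j) × (c ≤ a) × (b ≤ d)

  InSubtree : (ℓ a b j c d : ℕ) → Set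
  InSubtree ℓ a b j c d = LevelInt sp j c d × (j ≤ ℓ) × (a ≤ c) × (d ≤ b)

  -- A labeling: partial map from intervals to U = Fin m.
  Labeling : Set
  Labeling = ℕ → ℕ → ℕ → Maybe (Fin m)

  Feasible : (ℓ a b : ℕ) → Labeling → Set
  Feasible ℓ a b α =
    ∀ (t : Fin T) → a ≤ time t → time t < b →
      ∃ λ j → ∃ λ c → ∃ λ d →
        (InSubtree ℓ a b j c d ⊎ Ancestor ℓ a b j c d)
        × (c ≤ time t) × (time t < d) × (α j c d ≡ just (σ t))

  LabelIn : Labeling → Subset m → (j c d : ℕ) → Set
  LabelIn α S j c d = (α j c d ≡ nothing) ⊎ (∃ λ x → (α j c d ≡ just x) × (x ∈ S))

  ValidTuple : (ℓ a b : ℕ) → Subset m → Set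
  ValidTuple ℓ a b S =
    (∣ S ∣ ≤ k ∸ ℓ) ×
    (∃ λ α → Feasible ℓ a b α ×
       (∀ j c d → Ancestor ℓ a b j c d → LabelIn α S j c d))

  -- S ∈ L(I): inclusion-minimal valid tuple
  InRequestList : (ℓ a b : ℕ) → Subset m → Set
  InRequestList ℓ a b S =
    ValidTuple ℓ a b S × (∀ S' → S' ⊆ S → ValidTuple ℓ a b S' → S' ≡ S)

  JointValid : (ℓ a b : ℕ) → Subset m → Set
  JointValid ℓ a b S =
    (∣ S ∣ ≤ suc (k ∸ ℓ)) ×
    (∃ λ α → Feasible ℓ a b α × LabelIn α S ℓ a b ×
       (∀ j c d → Ancestor ℓ a b j c d → LabelIn α S j c d))

  -- S ∈ L(C) for C the children of I
  InJointList : (ℓ a b : ℕ) → Subset m → Set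
  InJointList ℓ a b S =
    JointValid ℓ a b S × (∀ S' → S' ⊆ S → JointValid ℓ a b S' → S' ≡ S)

-- "f(ℓ,t,h) ≤ N": for every finite U (= Fin m), request sequence, pattern,
-- level-ℓ interval I and P with |P| = h, every list of distinct t-tuples of
-- L(I) containing P has length ≤ N.
FBound : (k ℓ t h N : ℕ) → Set
FBound k ℓ t h N =
  ∀ (m T : ℕ) (σ : Fin T → Fin m) (sp : Pattern k T) (a b : ℕ) →
  LevelInt sp ℓ a b → (P : Subset m) → ∣ P ∣ ≡ h →
  (Ss : List (Subset m)) → Unique Ss →
  All (λ S → InRequestList sp σ ℓ a b S × (∣ S ∣ ≡ t) × (P ⊆ S)) Ss →
  length Ss ≤ N

-- "n(ℓ,t,h) ≤ N", analogously for joint request lists of children.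
NBound : (k ℓ t h N : ℕ) → Set
NBound k ℓ t h N =
  ∀ (m T : ℕ) (σ : Fin T → Fin m) (sp : Pattern k T) (a b : ℕ) →
  LevelInt sp ℓ a b → (P : Subset m) → ∣ P ∣ ≡ h →
  (Ss : List (Subset m)) → Unique Ss →
  All (λ S → InJointList sp σ ℓ a b S × (∣ S ∣ ≡ t) × (P ⊆ S)) Ss →
  length Ss ≤ N

-- Let S be a t-tuple of L(I) containing P, and let α be a labeling witnessing its validity.
-- Then α labels I itself, by a page x outside S: otherwise relabelling I by a page of S and
-- placing the remaining pages of S on distinct ancestors would make a proper subset of S
-- valid. Hence S ∪ {x} is a (t+1)-tuple of the joint list L(C), and minimality of S makes it
-- inclusion-minimal there. S is recovered from S ∪ {x} and x, and x from its rank among the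
-- t − h + 1 elements of (S ∪ {x}) ∖ P; so S ↦ (rank, S ∪ {x}) is injective and every rank
-- class has at most n(ℓ, t+1, h) members. For t = 0 the bound f(ℓ,0,0) ≤ 1 ≤ n(ℓ,1,0) needs
-- a pattern whose joint list contains a singleton: one level-ℓ interval whose ℓ requests
-- cannot all be served by the ℓ − 1 levels below it.
module Submission where

open import Defs
open import Data.Nat using (ℕ; zero; suc; _+_; _*_; _∸_; _≤_; _<_; z≤n; s≤s)
open import Data.Nat.Properties
open import Data.Fin using (Fin; zero; suc; toℕ; fromℕ<)
import Data.Fin.Properties as Fin
open import Data.Fin.Subset
  using (Subset; inside; outside; _∈_; _∉_; _⊆_; ∣_∣; _∪_; _─_; _-_; ⁅_⁆; ⊥; Nonempty; Empty)
open import Data.Fin.Subset.Properties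
  using (_∈?_; drop-∷-⊆; nonempty?; Empty-unique; ∣⊥∣≡0; x∈⁅x⁆; x∈⁅y⁆⇒x≡y; x∉⁅y⁆⇒x≢y;
         ∣⁅x⁆∣≡1; ⊆-antisym; ⊆-min; p⊆q⇒∣p∣≤∣q∣; p⊆p∪q; q⊆p∪q; x∈p∪q⁻; ∪-identityʳ;
         x∈p∧x∉q⇒x∈p─q; p─q⊆p; x∈p∧x≢y⇒x∈p-y; x∈p⇒∣p-x∣<∣p∣)
open import Data.Bool using (false)
open import Data.Vec using ([]; _∷_; here; there)
open import Data.Maybe using (Maybe; just; nothing)
import Data.Maybe as Maybe
open import Data.Maybe.Properties using (just-injective)
open import Data.List using (List; []; _∷_; length; map; filter)
open import Data.List.Properties using (length-map)
open import Data.List.Relation.Unary.All as All using (All; []; _∷_)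
open import Data.List.Relation.Unary.All.Properties
  using (all-filter) renaming (filter⁺ to All-filter⁺; map⁺ to All-map⁺)
open import Data.List.Relation.Unary.AllPairs as AllPairs using (AllPairs; []; _∷_)
import Data.List.Relation.Unary.AllPairs.Properties as AllPairs
open import Data.List.Relation.Unary.Unique.Propositional using (Unique)
open import Data.Product using (Σ; ∃; ∃₂; _×_; _,_; proj₁; proj₂)
open import Data.Product.Properties using (≡-dec)
open import Data.Sum using (_⊎_; inj₁; inj₂)
open import Relation.Nullary using (¬_; Dec; yes; no; contradiction)
open import Relation.Unary using (Decidable)
open import Relation.Unary.Properties using (∁?)
open import Relation.Binary.PropositionalEquality

-- Finite subsets

private
  variable
    n : ℕ

x∈p─q⇒x∉q : ∀ {x : Fin n} (p q : Subset n) → x ∈ p ─ q → x ∉ q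
x∈p─q⇒x∉q (_ ∷ p) (outside ∷ q) here ()
x∈p─q⇒x∉q (_ ∷ p) (_ ∷ q) (there x∈p─q) (there x∈q) = x∈p─q⇒x∉q p q x∈p─q x∈q

x∈p-y⇒x≢y : ∀ {x y : Fin n} (p : Subset n) → x ∈ p - y → x ≢ y
x∈p-y⇒x≢y {y = y} p x∈p-y = x∉⁅y⁆⇒x≢y (x∈p─q⇒x∉q p ⁅ y ⁆ x∈p-y)

x∉p-x : ∀ {x : Fin n} (p : Subset n) → x ∉ p - x
x∉p-x p x∈p-x = x∈p-y⇒x≢y p x∈p-x refl

x∈p∪⁅y⁆⁻ : ∀ {x y : Fin n} (p : Subset n) → x ∈ p ∪ ⁅ y ⁆ → x ∈ p ⊎ x ≡ y
x∈p∪⁅y⁆⁻ {y = y} p x∈ with x∈p∪q⁻ p ⁅ y ⁆ x∈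
... | inj₁ x∈p = inj₁ x∈p
... | inj₂ x∈⁅y⁆ = inj₂ (x∈⁅y⁆⇒x≡y y x∈⁅y⁆)

q⊆p∪⁅x⁆∧x∉q⇒q⊆p : ∀ {x : Fin n} {p q : Subset n} → q ⊆ p ∪ ⁅ x ⁆ → x ∉ q → q ⊆ p
q⊆p∪⁅x⁆∧x∉q⇒q⊆p {p = p} q⊆ x∉q y∈q with x∈p∪⁅y⁆⁻ p (q⊆ y∈q)
... | inj₁ y∈p = y∈p
... | inj₂ refl = contradiction y∈q x∉q

p∪⁅x⁆-x≡p : ∀ {x : Fin n} (p : Subset n) → x ∉ p → p ∪ ⁅ x ⁆ - x ≡ p
p∪⁅x⁆-x≡p {x = x} p x∉p = ⊆-antisym
  (q⊆p∪⁅x⁆∧x∉q⇒q⊆p (p─q⊆p (p ∪ ⁅ x ⁆) ⁅ x ⁆) (x∉p-x (p ∪ ⁅ x ⁆)))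
  (λ y∈p → x∈p∧x≢y⇒x∈p-y (p⊆p∪q ⁅ x ⁆ y∈p) (λ { refl → x∉p y∈p }))

p-x∪⁅x⁆≡p : ∀ {x : Fin n} (p : Subset n) → x ∈ p → (p - x) ∪ ⁅ x ⁆ ≡ p
p-x∪⁅x⁆≡p {x = x} p x∈p = ⊆-antisym ⊆p ⊇p
  where
  ⊆p : (p - x) ∪ ⁅ x ⁆ ⊆ p
  ⊆p y∈ with x∈p∪⁅y⁆⁻ (p - x) y∈
  ... | inj₁ y∈p-x = p─q⊆p p ⁅ x ⁆ y∈p-x
  ... | inj₂ refl = x∈p
  ⊇p : p ⊆ (p - x) ∪ ⁅ x ⁆
  ⊇p {y} y∈p with y Fin.≟ x
  ... | yes refl = q⊆p∪q (p - x) ⁅ x ⁆ (x∈⁅x⁆ x)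
  ... | no y≢x = p⊆p∪q ⁅ x ⁆ (x∈p∧x≢y⇒x∈p-y y∈p y≢x)

∣p∪⁅x⁆∣≡1+∣p∣ : ∀ {x : Fin n} (p : Subset n) → x ∉ p → ∣ p ∪ ⁅ x ⁆ ∣ ≡ suc ∣ p ∣
∣p∪⁅x⁆∣≡1+∣p∣ {x = zero}  (inside ∷ p)  x∉p = contradiction here x∉p
∣p∪⁅x⁆∣≡1+∣p∣ {x = zero}  (outside ∷ p) _   = cong (λ q → suc ∣ q ∣) (∪-identityʳ p)
∣p∪⁅x⁆∣≡1+∣p∣ {x = suc x} (inside ∷ p)  x∉p = cong suc (∣p∪⁅x⁆∣≡1+∣p∣ p (λ x∈p → x∉p (there x∈p)))
∣p∪⁅x⁆∣≡1+∣p∣ {x = suc x} (outside ∷ p) x∉p = ∣p∪⁅x⁆∣≡1+∣p∣ p (λ x∈p → x∉p (there x∈p))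

∣p─q∣+∣q∣≡∣p∣ : ∀ (p q : Subset n) → q ⊆ p → ∣ p ─ q ∣ + ∣ q ∣ ≡ ∣ p ∣
∣p─q∣+∣q∣≡∣p∣ []            []            _   = refl
∣p─q∣+∣q∣≡∣p∣ (inside ∷ p)  (inside ∷ q)  q⊆p =
  trans (+-suc ∣ p ─ q ∣ ∣ q ∣) (cong suc (∣p─q∣+∣q∣≡∣p∣ p q (drop-∷-⊆ q⊆p)))
∣p─q∣+∣q∣≡∣p∣ (outside ∷ p) (inside ∷ q)  q⊆p with () ← q⊆p here
∣p─q∣+∣q∣≡∣p∣ (inside ∷ p)  (outside ∷ q) q⊆p = cong suc (∣p─q∣+∣q∣≡∣p∣ p q (drop-∷-⊆ q⊆p))
∣p─q∣+∣q∣≡∣p∣ (outside ∷ p) (outside ∷ q) q⊆p = ∣p─q∣+∣q∣≡∣p∣ p q (drop-∷-⊆ q⊆p)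

∣p∣≡0⇒p≡⊥ : ∀ {p : Subset n} → ∣ p ∣ ≡ 0 → p ≡ ⊥
∣p∣≡0⇒p≡⊥ {p = p} ∣p∣≡0 = Empty-unique λ (x , x∈p) →
  n≮0 (subst₂ _≤_ (∣⁅x⁆∣≡1 x) ∣p∣≡0 (p⊆q⇒∣p∣≤∣q∣ λ y∈⁅x⁆ →
    subst (_∈ p) (sym (x∈⁅y⁆⇒x≡y x y∈⁅x⁆)) x∈p))

0<∣p∣⇒Nonempty : ∀ {p : Subset n} → 0 < ∣ p ∣ → Nonempty p
0<∣p∣⇒Nonempty {n = n} {p = p} 0<∣p∣ with nonempty? p
... | yes p-nonempty = p-nonempty
... | no p-empty    = contradiction (trans (cong ∣_∣ (Empty-unique p-empty)) (∣⊥∣≡0 n)) (>⇒≢ 0<∣p∣)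

-- nth p i is the i-th element of p in increasing order; rank p inverts it on p.

nth : Subset n → ℕ → Maybe (Fin n)
nth []            _       = nothing
nth (inside ∷ p)  zero    = just zero
nth (inside ∷ p)  (suc i) = Maybe.map suc (nth p i)
nth (outside ∷ p) i       = Maybe.map suc (nth p i)

rank : Subset n → Fin n → ℕ
rank (_ ∷ p)       zero    = 0
rank (inside ∷ p)  (suc x) = suc (rank p x)
rank (outside ∷ p) (suc x) = rank p x

rank<∣p∣ : ∀ {x : Fin n} (p : Subset n) → x ∈ p → rank p x < ∣ p ∣
rank<∣p∣ (inside ∷ p)  here        = s≤s z≤n
rank<∣p∣ (inside ∷ p)  (there x∈p) = s≤s (rank<∣p∣ p x∈p)
rank<∣p∣ (outside ∷ p) (there x∈p) = rank<∣p∣ p x∈p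

nth-rank : ∀ {x : Fin n} (p : Subset n) → x ∈ p → nth p (rank p x) ≡ just x
nth-rank (inside ∷ p)  here        = refl
nth-rank (inside ∷ p)  (there x∈p) = cong (Maybe.map suc) (nth-rank p x∈p)
nth-rank (outside ∷ p) (there x∈p) = cong (Maybe.map suc) (nth-rank p x∈p)

nth∈ : ∀ {x : Fin n} (p : Subset n) i → nth p i ≡ just x → x ∈ p
nth∈ (inside ∷ p)  zero    refl = here
nth∈ (inside ∷ p)  (suc i) eq with nth p i in nth≡
... | just _ with refl ← eq = there (nth∈ p i nth≡)
nth∈ (outside ∷ p) i       eq with nth p i in nth≡
... | just _ with refl ← eq = there (nth∈ p i nth≡)

rank-injective : ∀ {x y : Fin n} (p : Subset n) → x ∈ p → y ∈ p → rank p x ≡ rank p y → x ≡ y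
rank-injective p x∈p y∈p eq =
  just-injective (trans (sym (nth-rank p x∈p)) (trans (cong (nth p) eq) (nth-rank p y∈p)))

-- Counting a list along the fibres of a key

length-filter+length-filter-∁ : ∀ {A : Set} {P : A → Set} (P? : Decidable P) (xs : List A) →
                                length (filter P? xs) + length (filter (∁? P?) xs) ≡ length xs
length-filter+length-filter-∁ P? []       = refl
length-filter+length-filter-∁ P? (x ∷ xs) with P? x
... | yes _ = cong suc (length-filter+length-filter-∁ P? xs)
... | no _  = trans (+-suc _ _) (cong suc (length-filter+length-filter-∁ P? xs))

allPairs-restrict : ∀ {A : Set} {P : A → Set} {R S : A → A → Set} →
                    (∀ {x y} → P x → P y → R x y → S x y) →
                    ∀ {xs} → All P xs → AllPairs R xs → AllPairs S xs
allPairs-restrict R⇒S []         []         = []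
allPairs-restrict R⇒S (px ∷ pxs) (rx ∷ rxs) =
  All.zipWith (λ (py , rxy) → R⇒S px py rxy) (pxs , rx) ∷ allPairs-restrict R⇒S pxs rxs

map-proj₁-toList : ∀ {A : Set} {P : A → Set} {xs : List A} (pxs : All P xs) →
                   map proj₁ (All.toList pxs) ≡ xs
map-proj₁-toList []         = refl
map-proj₁-toList (px ∷ pxs) = cong (_ ∷_) (map-proj₁-toList pxs)

module _ {A B : Set} (key : A → ℕ) (f : A → B) {R : B → Set} {N : ℕ}
         (R-f : ∀ x → R (f x))
         (fibre-bound : ∀ bs → Unique bs → All R bs → length bs ≤ N) where

  length≤keys*N : ∀ c (xs : List A) → All (λ x → key x < c) xs →
                  AllPairs (λ x y → key x ≡ key y → f x ≢ f y) xs → length xs ≤ c * N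
  length≤keys*N zero    []      _        _        = z≤n
  length≤keys*N zero    (_ ∷ _) (() ∷ _) _
  length≤keys*N (suc c) xs      keys<1+c distinct = begin
      length xs                  ≡⟨ length-filter+length-filter-∁ onKey? xs ⟨
      length fibre + length rest ≤⟨ +-mono-≤ fibre≤N rest≤c*N ⟩
      N + c * N                  ∎
    where
    open ≤-Reasoning
    onKey? : Decidable (λ x → key x ≡ c)
    onKey? x = key x ≟ c
    fibre rest : List A
    fibre = filter onKey? xs
    rest  = filter (∁? onKey?) xs
    f-distinct-on-fibre : Unique (map f fibre)
    f-distinct-on-fibre = AllPairs.map⁺ (allPairs-restrict
      (λ kx≡c ky≡c f≢ → f≢ (trans kx≡c (sym ky≡c)))
      (all-filter onKey? xs) (AllPairs.filter⁺ onKey? distinct))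
    fibre≤N : length fibre ≤ N
    fibre≤N = subst (_≤ N) (length-map f fibre)
      (fibre-bound (map f fibre) f-distinct-on-fibre (All-map⁺ (All.universal R-f fibre)))
    rest≤c*N : length rest ≤ c * N
    rest≤c*N = length≤keys*N c rest
      (All.zipWith (λ (k<1+c , k≢c) → ≤∧≢⇒< (≤-pred k<1+c) k≢c)
        (All-filter⁺ (∁? onKey?) keys<1+c , all-filter (∁? onKey?) xs))
      (AllPairs.filter⁺ (∁? onKey?) distinct)

-- Counting tuples through one-element extensions

Extendable : ∀ {m} → (Subset m → Set) → ℕ → Subset m → Subset m → Set
Extendable J t P S = (∃ λ x → x ∉ S × J (S ∪ ⁅ x ⁆)) × ∣ S ∣ ≡ t × P ⊆ S

module _ {m : ℕ} (J : Subset m → Set) {t h N : ℕ} {P : Subset m} (∣P∣≡h : ∣ P ∣ ≡ h) (h≤t : h ≤ t)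
         (J-bound : ∀ Qs → Unique Qs → All (λ Q → J Q × ∣ Q ∣ ≡ suc t × P ⊆ Q) Qs → length Qs ≤ N)
         where

  extension : ∃ (Extendable J t P) → Subset m
  extension (S , (x , _) , _) = S ∪ ⁅ x ⁆

  extension-rank : ∃ (Extendable J t P) → ℕ
  extension-rank (S , (x , _) , _) = rank (S ∪ ⁅ x ⁆ ─ P) x

  new∈extension─P : ∀ {S x} → x ∉ S → P ⊆ S → x ∈ S ∪ ⁅ x ⁆ ─ P
  new∈extension─P {S} {x} x∉S P⊆S =
    x∈p∧x∉q⇒x∈p─q (q⊆p∪q S ⁅ x ⁆ (x∈⁅x⁆ x)) (λ x∈P → x∉S (P⊆S x∈P))

  extension-in-J : ∀ e → J (extension e) × ∣ extension e ∣ ≡ suc t × P ⊆ extension e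
  extension-in-J (S , (x , x∉S , J[S∪x]) , ∣S∣≡t , P⊆S) =
    J[S∪x] , trans (∣p∪⁅x⁆∣≡1+∣p∣ S x∉S) (cong suc ∣S∣≡t) , (λ y∈P → p⊆p∪q ⁅ x ⁆ (P⊆S y∈P))

  extension-rank< : ∀ e → extension-rank e < t ∸ h + 1
  extension-rank< e@(S , (x , x∉S , _) , _ , P⊆S) =
    subst (extension-rank e <_) ∣Q─P∣≡t-h+1 (rank<∣p∣ (Q ─ P) (new∈extension─P x∉S P⊆S))
    where
    Q = extension e
    ∣Q∣≡1+t : ∣ Q ∣ ≡ suc t
    ∣Q∣≡1+t = proj₁ (proj₂ (extension-in-J e))
    P⊆Q : P ⊆ Q
    P⊆Q = proj₂ (proj₂ (extension-in-J e))
    ∣Q─P∣≡t-h+1 : ∣ Q ─ P ∣ ≡ t ∸ h + 1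
    ∣Q─P∣≡t-h+1 = begin
      ∣ Q ─ P ∣               ≡⟨ m+n∸n≡m ∣ Q ─ P ∣ h ⟨
      ∣ Q ─ P ∣ + h ∸ h       ≡⟨ cong (λ n → ∣ Q ─ P ∣ + n ∸ h) ∣P∣≡h ⟨
      ∣ Q ─ P ∣ + ∣ P ∣ ∸ h   ≡⟨ cong (_∸ h) (∣p─q∣+∣q∣≡∣p∣ Q P P⊆Q) ⟩
      ∣ Q ∣ ∸ h               ≡⟨ cong (_∸ h) (trans ∣Q∣≡1+t (+-comm 1 t)) ⟩
      t + 1 ∸ h               ≡⟨ +-∸-comm 1 h≤t ⟩
      t ∸ h + 1               ∎
      where open ≡-Reasoning

  extension-rank-injective : ∀ {e e'} → extension-rank e ≡ extension-rank e' →
                             extension e ≡ extension e' → proj₁ e ≡ proj₁ e'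
  extension-rank-injective {S , (x , x∉S , _) , _ , P⊆S} {S' , (x' , x'∉S' , _) , _ , P⊆S'}
                           rank≡ Q≡Q' = begin
      S                ≡⟨ p∪⁅x⁆-x≡p S x∉S ⟨
      S ∪ ⁅ x ⁆ - x    ≡⟨ cong₂ _-_ Q≡Q' x≡x' ⟩
      S' ∪ ⁅ x' ⁆ - x' ≡⟨ p∪⁅x⁆-x≡p S' x'∉S' ⟩
      S'               ∎
    where
    open ≡-Reasoning
    x≡x' : x ≡ x'
    x≡x' = rank-injective (S ∪ ⁅ x ⁆ ─ P) (new∈extension─P x∉S P⊆S)
      (subst (λ Q → x' ∈ Q ─ P) (sym Q≡Q') (new∈extension─P x'∉S' P⊆S'))
      (trans rank≡ (cong (λ Q → rank (Q ─ P) x') (sym Q≡Q')))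

  extendables-length≤ : ∀ Ss → Unique Ss → All (Extendable J t P) Ss → length Ss ≤ (t ∸ h + 1) * N
  extendables-length≤ Ss unique extendable = begin
      length Ss             ≡⟨ cong length (map-proj₁-toList extendable) ⟨
      length (map proj₁ es) ≡⟨ length-map proj₁ es ⟩
      length es             ≤⟨ length≤keys*N extension-rank extension extension-in-J J-bound
                                 (t ∸ h + 1) es (All.universal extension-rank< es) distinct ⟩
      (t ∸ h + 1) * N       ∎
    where
    open ≤-Reasoning
    es : List (∃ (Extendable J t P))
    es = All.toList extendable
    distinct : AllPairs (λ e e' → extension-rank e ≡ extension-rank e' →
                                  extension e ≢ extension e') es
    distinct = AllPairs.map
      (λ {e} {e'} S≢S' rank≡ Q≡Q' → S≢S' (extension-rank-injective {e} {e'} rank≡ Q≡Q'))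
      (AllPairs.map⁻ (subst Unique (sym (map-proj₁-toList extendable)) unique))

-- Relabelling intervals of a service pattern

_≟³_ : (x y : ℕ × ℕ × ℕ) → Dec (x ≡ y)
_≟³_ = ≡-dec _≟_ (≡-dec _≟_ _≟_)

module _ {k T m : ℕ} (sp : Pattern k T) (σ : Fin T → Fin m) where

  Serves : (ℓ a b : ℕ) → Labeling sp σ → Fin T → Set
  Serves ℓ a b α t = ∃ λ j → ∃ λ c → ∃ λ d →
    (InSubtree sp σ ℓ a b j c d ⊎ Ancestor sp σ ℓ a b j c d)
    × (c ≤ time t) × (time t < d) × (α j c d ≡ just (σ t))

  ancestorAt : ∀ {ℓ a b j} → LevelInt sp ℓ a b → ℓ < j → j ≤ k →
               ∃₂ λ c d → Ancestor sp σ ℓ a b j c d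
  ancestorAt {ℓ} {a} {b} {suc j} I ℓ<1+j 1+j≤k with m≤n⇒m<n∨m≡n (≤-pred ℓ<1+j)
  ... | inj₂ refl
    with c , d , J , c≤a , b≤d ← nested sp ℓ a b I 1+j≤k
    = c , d , J , ℓ<1+j , c≤a , b≤d
  ... | inj₁ ℓ<j
    with c , d , J , _ , c≤a , b≤d ← ancestorAt I ℓ<j (≤-trans (n≤1+n j) 1+j≤k)
    with c' , d' , J' , c'≤c , d≤d' ← nested sp j c d J 1+j≤k
    = c' , d' , J' , ℓ<1+j , ≤-trans c'≤c c≤a , ≤-trans b≤d d≤d'

  relabel : (ℓ a b : ℕ) → Fin m → Subset m → Labeling sp σ → Labeling sp σ
  relabel ℓ a b x S α j c d with (j , c , d) ≟³ (ℓ , a , b) | ℓ <? j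
  ... | yes _ | _     = just x
  ... | no _  | yes _ = nth S (j ∸ suc ℓ)
  ... | no _  | no _  = α j c d

  relabel-self : ∀ {ℓ a b x S α} → relabel ℓ a b x S α ℓ a b ≡ just x
  relabel-self {ℓ} {a} {b} with (ℓ , a , b) ≟³ (ℓ , a , b) | ℓ <? ℓ
  ... | yes _   | _ = refl
  ... | no ≢self | _ = contradiction refl ≢self

  relabel-above : ∀ {ℓ a b x S α} j c d → ℓ < j → relabel ℓ a b x S α j c d ≡ nth S (j ∸ suc ℓ)
  relabel-above {ℓ} {a} {b} j c d ℓ<j with (j , c , d) ≟³ (ℓ , a , b) | ℓ <? j
  ... | yes refl | _      = contradiction ℓ<j (<-irrefl refl)
  ... | no _     | yes _  = refl
  ... | no _     | no ℓ≮j = contradiction ℓ<j ℓ≮j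

  relabel-below : ∀ {ℓ a b x S α} j c d → (j , c , d) ≢ (ℓ , a , b) → j ≤ ℓ →
                  relabel ℓ a b x S α j c d ≡ α j c d
  relabel-below {ℓ} {a} {b} j c d ≢I j≤ℓ with (j , c , d) ≟³ (ℓ , a , b) | ℓ <? j
  ... | yes ≡I | _      = contradiction ≡I ≢I
  ... | no _   | yes ℓ<j = contradiction j≤ℓ (<⇒≱ ℓ<j)
  ... | no _   | no _   = refl

  labelIn-mono : ∀ α {S S' j c d} → S ⊆ S' → LabelIn sp σ α S j c d → LabelIn sp σ α S' j c d
  labelIn-mono _ S⊆S' (inj₁ unlabelled)        = inj₁ unlabelled
  labelIn-mono _ S⊆S' (inj₂ (y , α≡y , y∈S)) = inj₂ (y , α≡y , S⊆S' y∈S)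

  labelIn-just : ∀ α {S j c d y} → LabelIn sp σ α S j c d → α j c d ≡ just y → y ∈ S
  labelIn-just _ (inj₁ unlabelled) α≡y with () ← trans (sym unlabelled) α≡y
  labelIn-just _ (inj₂ (z , α≡z , z∈S)) α≡y with refl ← trans (sym α≡z) α≡y = z∈S

  labelIn-nth : ∀ α {S j c d} i → α j c d ≡ nth S i → LabelIn sp σ α S j c d
  labelIn-nth _ {S} i α≡ with nth S i in nth≡
  ... | nothing = inj₁ α≡
  ... | just y  = inj₂ (y , α≡ , nth∈ S i nth≡)

  labelIn-Empty : ∀ α {S j c d} → Empty S → LabelIn sp σ α S j c d → α j c d ≡ nothing
  labelIn-Empty _ S-empty (inj₁ unlabelled)     = unlabelled
  labelIn-Empty _ S-empty (inj₂ (y , _ , y∈S)) = contradiction (y , y∈S) S-empty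

  relabel-serves : ∀ {ℓ a b x S α} → LevelInt sp ℓ a b → ∣ S ∣ ≤ k ∸ ℓ →
                   ∀ t → a ≤ time t → time t < b → σ t ≡ x ⊎ σ t ∈ S →
                   Serves ℓ a b (relabel ℓ a b x S α) t
  relabel-serves {ℓ} {a} {b} {x} {S} {α} I _ t a≤t t<b (inj₁ σt≡x) =
    ℓ , a , b , inj₁ (I , ≤-refl , ≤-refl , ≤-refl) , a≤t , t<b ,
    trans (relabel-self {ℓ} {a} {b} {x} {S} {α}) (cong just (sym σt≡x))
  relabel-serves {ℓ} {a} {b} {x} {S} {α} I ∣S∣≤k-ℓ t a≤t t<b (inj₂ σt∈S) =
    let c , d , A@(_ , _ , c≤a , b≤d) = ancestorAt I ℓ<j j≤k
    in  j , c , d , inj₂ A , ≤-trans c≤a a≤t , <-≤-trans t<b b≤d , γ≡σt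
    where
    i j : ℕ
    i = rank S (σ t)
    j = i + suc ℓ
    ℓ<j : ℓ < j
    ℓ<j = m≤n+m (suc ℓ) i
    j≤k : j ≤ k
    j≤k = begin
      i + suc ℓ   ≡⟨ +-suc i ℓ ⟩
      suc i + ℓ   ≤⟨ +-monoˡ-≤ ℓ (≤-trans (rank<∣p∣ S σt∈S) ∣S∣≤k-ℓ) ⟩
      k ∸ ℓ + ℓ   ≡⟨ m∸n+n≡m (proj₁ (proj₂ I)) ⟩
      k           ∎
      where open ≤-Reasoning
    γ≡σt : ∀ {c d} → relabel ℓ a b x S α j c d ≡ just (σ t)
    γ≡σt {c} {d} = begin
      relabel ℓ a b x S α j c d ≡⟨ relabel-above {x = x} {S} {α} j c d ℓ<j ⟩
      nth S (i + suc ℓ ∸ suc ℓ)  ≡⟨ cong (nth S) (m+n∸n≡m i (suc ℓ)) ⟩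
      nth S i                    ≡⟨ nth-rank S σt∈S ⟩
      just (σ t)                 ∎
      where open ≡-Reasoning

  -- Relabel I by x and the ancestors of I, level by level, by the pages of S - x: a request
  -- that α served by I or by an ancestor asks for a page of S, and S - x fits on the k - ℓ
  -- ancestor levels.
  jointValid⇒validTuple[S-x] : ∀ {ℓ a b S x} → LevelInt sp ℓ a b → x ∈ S →
                               JointValid sp σ ℓ a b S → ValidTuple sp σ ℓ a b (S - x)
  jointValid⇒validTuple[S-x] {ℓ} {a} {b} {S} {x} I x∈S
                             (∣S∣≤1+k-ℓ , α , feasible , I-labelled , A-labelled) =
    ∣S-x∣≤k-ℓ , γ , γ-feasible , γ-A-labelled
    where
    ∣S-x∣≤k-ℓ : ∣ S - x ∣ ≤ k ∸ ℓ
    ∣S-x∣≤k-ℓ = ≤-pred (≤-trans (x∈p⇒∣p-x∣<∣p∣ x∈S) ∣S∣≤1+k-ℓ)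
    γ : Labeling sp σ
    γ = relabel ℓ a b x (S - x) α
    serves-S : ∀ t → a ≤ time t → time t < b → σ t ∈ S → Serves ℓ a b γ t
    serves-S t a≤t t<b σt∈S with σ t Fin.≟ x
    ... | yes σt≡x = relabel-serves {α = α} I ∣S-x∣≤k-ℓ t a≤t t<b (inj₁ σt≡x)
    ... | no σt≢x  = relabel-serves {α = α} I ∣S-x∣≤k-ℓ t a≤t t<b (inj₂ (x∈p∧x≢y⇒x∈p-y σt∈S σt≢x))
    γ-feasible : Feasible sp σ ℓ a b γ
    γ-feasible t a≤t t<b with feasible t a≤t t<b
    ... | j , c , d , inj₂ A , _ , _ , α≡σt =
      serves-S t a≤t t<b (labelIn-just α (A-labelled j c d A) α≡σt)
    ... | j , c , d , inj₁ D , c≤t , t<d , α≡σt with (j , c , d) ≟³ (ℓ , a , b)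
    ...   | yes refl = serves-S t a≤t t<b (labelIn-just α I-labelled α≡σt)
    ...   | no ≢I    = j , c , d , inj₁ D , c≤t , t<d ,
                       trans (relabel-below {x = x} {S - x} {α} j c d ≢I (proj₁ (proj₂ D))) α≡σt
    γ-A-labelled : ∀ j c d → Ancestor sp σ ℓ a b j c d → LabelIn sp σ γ (S - x) j c d
    γ-A-labelled j c d (_ , ℓ<j , _) =
      labelIn-nth γ {j = j} {c} {d} (j ∸ suc ℓ) (relabel-above {x = x} {S - x} {α} j c d ℓ<j)

  jointValid⊆requestList⇒Empty : ∀ {ℓ a b S S'} → LevelInt sp ℓ a b → InRequestList sp σ ℓ a b S →
                                 S' ⊆ S → JointValid sp σ ℓ a b S' → Empty S'
  jointValid⊆requestList⇒Empty {S = S} {S'} I (_ , minimal) S'⊆S S'-valid (y , y∈S') =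
    x∉p-x S' (subst (y ∈_) (sym S'-y≡S) (S'⊆S y∈S'))
    where
    S'-y≡S : S' - y ≡ S
    S'-y≡S = minimal (S' - y) (λ z∈ → S'⊆S (p─q⊆p S' ⁅ y ⁆ z∈))
                     (jointValid⇒validTuple[S-x] I y∈S' S'-valid)

  witness-labels-I-outside : ∀ {ℓ a b S α} → LevelInt sp ℓ a b → InRequestList sp σ ℓ a b S →
    Nonempty S → Feasible sp σ ℓ a b α →
    (∀ j c d → Ancestor sp σ ℓ a b j c d → LabelIn sp σ α S j c d) →
    ¬ LabelIn sp σ α S ℓ a b
  witness-labels-I-outside {α = α} I S∈L@((∣S∣≤k-ℓ , _) , _) S-nonempty feasible A-labelled I-labelled =
    jointValid⊆requestList⇒Empty I S∈L (λ y∈S → y∈S)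
      (≤-trans ∣S∣≤k-ℓ (n≤1+n _) , α , feasible , I-labelled , A-labelled) S-nonempty

  requestList⇒extension : ∀ {ℓ a b S} → LevelInt sp ℓ a b → InRequestList sp σ ℓ a b S →
                          Nonempty S →
                          ∃ λ x → x ∉ S × InJointList sp σ ℓ a b (S ∪ ⁅ x ⁆)
  requestList⇒extension {ℓ} {a} {b} {S} I S∈L@((∣S∣≤k-ℓ , α , feasible , A-labelled) , minimal) S-nonempty
    with α ℓ a b in α-I
  ... | nothing = contradiction (inj₁ α-I) (witness-labels-I-outside I S∈L S-nonempty feasible A-labelled)
  ... | just x with x ∈? S
  ...   | yes x∈S = contradiction (inj₂ (x , α-I , x∈S))
                                (witness-labels-I-outside I S∈L S-nonempty feasible A-labelled)
  ...   | no x∉S  = x , x∉S , Q-valid , Q-minimal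
    where
    Q : Subset m
    Q = S ∪ ⁅ x ⁆
    Q-valid : JointValid sp σ ℓ a b Q
    Q-valid = subst (_≤ suc (k ∸ ℓ)) (sym (∣p∪⁅x⁆∣≡1+∣p∣ S x∉S)) (s≤s ∣S∣≤k-ℓ) , α , feasible ,
              inj₂ (x , α-I , q⊆p∪q S ⁅ x ⁆ (x∈⁅x⁆ x)) ,
              (λ j c d A → labelIn-mono α (p⊆p∪q ⁅ x ⁆) (A-labelled j c d A))
    Q-minimal : ∀ S' → S' ⊆ Q → JointValid sp σ ℓ a b S' → S' ≡ Q
    Q-minimal S' S'⊆Q S'-valid with x ∈? S'
    ... | yes x∈S' = begin
          S'                ≡⟨ p-x∪⁅x⁆≡p S' x∈S' ⟨
          (S' - x) ∪ ⁅ x ⁆  ≡⟨ cong (_∪ ⁅ x ⁆) S'-x≡S ⟩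
          Q                 ∎
      where
      open ≡-Reasoning
      S'-x≡S : S' - x ≡ S
      S'-x≡S = minimal (S' - x)
        (q⊆p∪⁅x⁆∧x∉q⇒q⊆p (λ z∈ → S'⊆Q (p─q⊆p S' ⁅ x ⁆ z∈)) (x∉p-x S'))
        (jointValid⇒validTuple[S-x] I x∈S' S'-valid)
    ... | no x∉S' = contradiction (subst Nonempty (sym S'≡S) S-nonempty)
                      (jointValid⊆requestList⇒Empty I S∈L S'⊆S S'-valid)
      where
      S'⊆S : S' ⊆ S
      S'⊆S = q⊆p∪⁅x⁆∧x∉q⇒q⊆p S'⊆Q x∉S'
      S'≡S : S' ≡ S
      S'≡S = let _ , β , β-feasible , _ , β-A-labelled = S'-valid in
        minimal S' S'⊆S (≤-trans (p⊆q⇒∣p∣≤∣q∣ S'⊆S) ∣S∣≤k-ℓ , β , β-feasible , β-A-labelled)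

-- ℓ pages, each requested once inside the single level-ℓ interval I of a pattern without cuts;
-- the ℓ - 1 levels below I have one interval each, so they cannot serve all requests and the
-- joint list of the children of I contains ⁅ 0 ⁆.
module OneIntervalPerLevel (k L : ℕ) (1+L<k : suc L < k) where

  ℓ : ℕ
  ℓ = suc L

  uncut : Pattern k ℓ
  uncut = record
    { cut    = λ _ _ → false
    ; nested = λ _ _ _ (_ , _ , _ , b≤1+ℓ , _) i<k →
        0 , suc ℓ ,
        (s≤s z≤n , i<k , s≤s z≤n , ≤-refl , inj₁ refl , inj₂ (inj₁ refl) , λ _ _ _ ()) ,
        z≤n , b≤1+ℓ
    }

  whole : ∀ {i} → 1 ≤ i → i ≤ k → LevelInt uncut i 0 (suc ℓ)
  whole 1≤i i≤k = 1≤i , i≤k , s≤s z≤n , ≤-refl , inj₁ refl , inj₂ (inj₁ refl) , λ _ _ _ ()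

  only-whole : ∀ {i a b} → LevelInt uncut i a b → a ≡ 0 × b ≡ suc ℓ
  only-whole {i} {a} {b} (_ , _ , a<b , b≤1+ℓ , a-boundary , b-boundary , _) =
    left a-boundary , right b-boundary
    where
    left : Boundary uncut i a → a ≡ 0
    left (inj₁ a≡0)                = a≡0
    left (inj₂ (inj₁ refl))        = contradiction (<-≤-trans a<b b≤1+ℓ) (<-irrefl refl)
    left (inj₂ (inj₂ (_ , _ , ())))
    right : Boundary uncut i b → b ≡ suc ℓ
    right (inj₁ refl)               = contradiction a<b n≮0
    right (inj₂ (inj₁ b≡1+ℓ))       = b≡1+ℓ
    right (inj₂ (inj₂ (_ , _ , ())))

  I : LevelInt uncut ℓ 0 (suc ℓ)
  I = whole (s≤s z≤n) (<⇒≤ 1+L<k)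

  σ : Fin ℓ → Fin ℓ
  σ i = i

  α : Labeling uncut σ
  α j _ _ with j <? ℓ
  ... | yes j<ℓ = just (fromℕ< j<ℓ)
  ... | no _    = just zero

  α-below : ∀ {j c d} (j<ℓ : j < ℓ) → α j c d ≡ just (fromℕ< j<ℓ)
  α-below {j} j<ℓ with j <? ℓ
  ... | yes _   = refl
  ... | no j≮ℓ = contradiction j<ℓ j≮ℓ

  α-from-I : ∀ {j c d} → ℓ ≤ j → α j c d ≡ just zero
  α-from-I {j} ℓ≤j with j <? ℓ
  ... | yes j<ℓ = contradiction ℓ≤j (<⇒≱ j<ℓ)
  ... | no _    = refl

  α-feasible : Feasible uncut σ ℓ 0 (suc ℓ) α
  α-feasible zero    _ t<b = ℓ , 0 , suc ℓ , inj₁ (I , ≤-refl , ≤-refl , ≤-refl) , z≤n , t<b ,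
                             α-from-I {c = 0} {suc ℓ} ≤-refl
  α-feasible (suc i) _ t<b = toℕ (suc i) , 0 , suc ℓ ,
    inj₁ (whole (s≤s z≤n) (≤-trans (<⇒≤ i<ℓ) (<⇒≤ 1+L<k)) , <⇒≤ i<ℓ , z≤n , ≤-refl) ,
    z≤n , t<b , trans (α-below {c = 0} {suc ℓ} i<ℓ) (cong just (Fin.fromℕ<-toℕ (suc i) i<ℓ))
    where
    i<ℓ : toℕ (suc i) < ℓ
    i<ℓ = Fin.toℕ<n (suc i)

  serving-level : ∀ {β} → Feasible uncut σ ℓ 0 (suc ℓ) β → β ℓ 0 (suc ℓ) ≡ nothing →
                  (∀ j c d → Ancestor uncut σ ℓ 0 (suc ℓ) j c d → β j c d ≡ nothing) →
                  (i : Fin ℓ) → Σ (Fin L) λ j → β (suc (toℕ j)) 0 (suc ℓ) ≡ just i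
  serving-level {β} feasible I-unlabelled A-unlabelled i with feasible i z≤n (s≤s (Fin.toℕ<n i))
  ... | j , c , d , inj₂ A , _ , _ , β≡i =
    contradiction (trans (sym (A-unlabelled j c d A)) β≡i) λ ()
  ... | j , c , d , inj₁ (J , j≤ℓ , _) , _ , _ , β≡i with only-whole J | proj₁ J | m≤n⇒m<n∨m≡n j≤ℓ
  ...   | refl , refl | _        | inj₂ refl = contradiction (trans (sym I-unlabelled) β≡i) λ ()
  ...   | refl , refl | s≤s z≤n | inj₁ (s≤s j'<L) =
    fromℕ< j'<L , subst (λ j' → β (suc j') 0 (suc ℓ) ≡ just i) (sym (Fin.toℕ-fromℕ< j'<L)) β≡i

  ⁅0⁆∈jointList : InJointList uncut σ ℓ 0 (suc ℓ) ⁅ zero ⁆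
  ⁅0⁆∈jointList =
    (subst (_≤ suc (k ∸ ℓ)) (sym (∣⁅x⁆∣≡1 {n = ℓ} zero)) (s≤s z≤n) , α , α-feasible ,
     inj₂ (zero , α-from-I {c = 0} {suc ℓ} ≤-refl , x∈⁅x⁆ zero) ,
     (λ j c d (_ , ℓ<j , _) → inj₂ (zero , α-from-I {j} {c} {d} (<⇒≤ ℓ<j) , x∈⁅x⁆ zero))) ,
    minimal
    where
    minimal : ∀ S' → S' ⊆ ⁅ zero ⁆ → JointValid uncut σ ℓ 0 (suc ℓ) S' → S' ≡ ⁅ zero ⁆
    minimal S' S'⊆⁅0⁆ (_ , β , feasible , I-labelled , A-labelled) with zero ∈? S'
    ... | yes 0∈S' = ⊆-antisym S'⊆⁅0⁆ (λ y∈⁅0⁆ → subst (_∈ S') (sym (x∈⁅y⁆⇒x≡y zero y∈⁅0⁆)) 0∈S')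
    ... | no 0∉S'  =
      contradiction (λ {i} {i'} → level-injective {i} {i'}) (Fin.<⇒notInjective (n<1+n L))
      where
      S'-empty : Empty S'
      S'-empty (y , y∈S') = 0∉S' (subst (_∈ S') (x∈⁅y⁆⇒x≡y zero (S'⊆⁅0⁆ y∈S')) y∈S')
      level : (i : Fin ℓ) → Σ (Fin L) λ j → β (suc (toℕ j)) 0 (suc ℓ) ≡ just i
      level = serving-level feasible (labelIn-Empty uncut σ β S'-empty I-labelled)
        (λ j c d A → labelIn-Empty uncut σ β S'-empty (A-labelled j c d A))
      level-injective : ∀ {i i'} → proj₁ (level i) ≡ proj₁ (level i') → i ≡ i'
      level-injective {i} {i'} j≡j' = just-injective (begin
        just i                                       ≡⟨ proj₂ (level i) ⟨
        β (suc (toℕ (proj₁ (level i)))) 0 (suc ℓ)   ≡⟨ cong (λ j → β (suc (toℕ j)) 0 (suc ℓ)) j≡j' ⟩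
        β (suc (toℕ (proj₁ (level i')))) 0 (suc ℓ)  ≡⟨ proj₂ (level i') ⟩
        just i'                                      ∎)
        where open ≡-Reasoning

nBound-positive : ∀ {k ℓ N} → 1 ≤ ℓ → ℓ < k → NBound k ℓ 1 0 N → 1 ≤ N
nBound-positive {k} {suc L} _ ℓ<k nBound =
  nBound (suc L) (suc L) σ uncut 0 (suc (suc L)) I ⊥ (∣⊥∣≡0 (suc L))
    (⁅ zero ⁆ ∷ []) ([] ∷ []) ((⁅0⁆∈jointList , ∣⁅x⁆∣≡1 {n = suc L} zero , ⊆-min ⁅ zero ⁆) ∷ [])
  where open OneIntervalPerLevel k L ℓ<k

unique-empty-sets-length≤1 : ∀ (Ss : List (Subset n)) → Unique Ss → All (λ S → ∣ S ∣ ≡ 0) Ss →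
                             length Ss ≤ 1
unique-empty-sets-length≤1 []           _                   _                       = z≤n
unique-empty-sets-length≤1 (_ ∷ [])     _                   _                       = s≤s z≤n
unique-empty-sets-length≤1 (_ ∷ _ ∷ _) ((S≢S' ∷ _) ∷ _) (∣S∣≡0 ∷ ∣S'∣≡0 ∷ _) =
  contradiction (trans (∣p∣≡0⇒p≡⊥ ∣S∣≡0) (sym (∣p∣≡0⇒p≡⊥ ∣S'∣≡0))) S≢S'

mainTheorem7 : ∀ (k ℓ t h : ℕ) → 2 ≤ k → 2 ≤ ℓ → ℓ < k → h ≤ t →
               ∀ (N : ℕ) → NBound k ℓ (suc t) h N →
               FBound k ℓ t h ((t ∸ h + 1) * N)
mainTheorem7 k ℓ zero .zero _ 2≤ℓ ℓ<k z≤n N nBound m T σ sp a b I P _ Ss unique tuples =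
  begin
    length Ss ≤⟨ unique-empty-sets-length≤1 Ss unique (All.map (λ (_ , ∣S∣≡0 , _) → ∣S∣≡0) tuples) ⟩
    1         ≤⟨ nBound-positive (≤-trans (s≤s z≤n) 2≤ℓ) ℓ<k nBound ⟩
    N         ≤⟨ m≤m+n N 0 ⟩
    N + 0     ∎
  where open ≤-Reasoning
mainTheorem7 k ℓ (suc t) h _ _ _ h≤1+t N nBound m T σ sp a b I P ∣P∣≡h Ss unique tuples =
  extendables-length≤ (InJointList sp σ ℓ a b) ∣P∣≡h h≤1+t (nBound m T σ sp a b I P ∣P∣≡h)
    Ss unique (All.map extendable tuples)
  where
  extendable : ∀ {S} → InRequestList sp σ ℓ a b S × ∣ S ∣ ≡ suc t × P ⊆ S →
               Extendable (InJointList sp σ ℓ a b) (suc t) P S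
  extendable (S∈L , ∣S∣≡1+t , P⊆S) =
    requestList⇒extension sp σ I S∈L (0<∣p∣⇒Nonempty (subst (0 <_) (sym ∣S∣≡1+t) (s≤s z≤n))) ,
    ∣S∣≡1+t , P⊆S
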